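{- Let $R$ be a nonzero commutative ring. For every $n\ge1$, every $f\in R[[x]]$ with $\overline T^n(f)=f$ belongs to $\mathcal S_R=\{u(1+xv)^{ -1}\mid u,v\in R[x]\}\subset R[[x]]$.
   Context: For $f\in R[[x]]$ with constant coefficient $f_0$, the modified Collatz map is $\overline T(f)=\frac{(x+1)f-f_0}{x}$ if $f_0\neq0$ and $\overline T(f)=\frac{f}{x}$ otherwise. -}

module Defs where

open import Level using (Level; _⊔_)
open import Data.Nat using (ℕ; zero; suc; _∸_)
open import Data.List using (List; []; _∷_)
open import Data.Product using (Σ; _×_; ∃₂)
open import Data.Sum using (_⊎_)
open import Relation.Nullary using (¬_)
open import Algebra.Bundles using (CommutativeRing)

module PowerSeries {c ℓ : Level} (R : CommutativeRing c ℓ) where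
  open CommutativeRing R using (Carrier; _≈_; _+_; _*_; 0#; 1#)

  PS : Set c
  PS = ℕ → Carrier

  _≈ₚ_ : PS → PS → Set ℓ
  f ≈ₚ g = ∀ k → f k ≈ g k

  -- Polynomials R[x] as coefficient lists (constant term first), viewed in R[[x]].
  Poly : Set c
  Poly = List Carrier

  ⟦_⟧ : Poly → PS
  ⟦ [] ⟧     k       = 0#
  ⟦ a ∷ p ⟧ zero    = a
  ⟦ a ∷ p ⟧ (suc k) = ⟦ p ⟧ k

  sumTo : ℕ → (ℕ → Carrier) → Carrier
  sumTo zero    h = h zero
  sumTo (suc n) h = sumTo n h + h (suc n)

  _·_ : PS → PS → PS
  (f · g) n = sumTo n (λ i → f i * g (n ∸ i))

  onePlusX : Poly → PS
  onePlusX v zero    = 1#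
  onePlusX v (suc k) = ⟦ v ⟧ k

  -- f ∈ S_R = { u (1+xv)⁻¹ | u,v ∈ R[x] }.  Since 1+xv is a unit of R[[x]],
  -- f = u (1+xv)⁻¹  iff  f·(1+xv) = u.
  InS : PS → Set (c ⊔ ℓ)
  InS f = ∃₂ λ (u v : Poly) → (f · onePlusX v) ≈ₚ ⟦ u ⟧

  divX : PS → PS
  divX f k = f (suc k)

  -- Coefficients of ((x+1)f − f₀)/x :  k-th coefficient = f_{k+1} + f_k
  stepNZ : PS → PS
  stepNZ f k = f (suc k) + f k

  -- Graph of the modified Collatz map T̄ (stated relationally, so that the
  -- case split "f₀ ≠ 0 / f₀ = 0" needs no decidability of equality in R).
  Tbar : PS → PS → Set ℓ
  Tbar f g = ((¬ (f 0 ≈ 0#)) × (g ≈ₚ stepNZ f)) ⊎ ((f 0 ≈ 0#) × (g ≈ₚ divX f))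

  TbarPow : ℕ → PS → PS → Set (c ⊔ ℓ)
  TbarPow zero    f g = Level.Lift c (f ≈ₚ g)
  TbarPow (suc n) f h = Σ PS λ g → Tbar f g × TbarPow n g h

{-# OPTIONS --safe #-}
-- Write e = 1 if f₀ ≠ 0 and e = 0 otherwise; then x·T̄(f) = (1 + e x) f − f₀.
-- Iterating, xⁿ T̄ⁿ(f) = P f − u for polynomials P, u with P(0) = 1.  If
-- T̄ⁿ(f) = f with n ≥ 1, then (P − xⁿ) f = u, and P − xⁿ = 1 + x v.
module Submission where

open import Defs
open import Level using (Level; _⊔_)
open import Data.Nat using (ℕ; _≤_; zero; suc; _∸_; z≤n)
open import Data.Nat.Properties using (≤-refl; m≤n⇒m≤1+n; n∸n≡0; +-∸-assoc)
open import Data.List using ([]; _∷_; map)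
open import Data.Product using (∃; ∃₂; _,_)
open import Data.Sum using (inj₁; inj₂)
open import Relation.Nullary using (¬_)
open import Relation.Binary.PropositionalEquality using (cong)
open import Algebra.Bundles using (CommutativeRing)
import Algebra.Construct.Pointwise as Pointwise
import Algebra.Properties.AbelianGroup as AbelianGroupProperties
import Algebra.Properties.CommutativeSemigroup as CommutativeSemigroupProperties
import Algebra.Properties.Ring as RingProperties
import Relation.Binary.Reasoning.Setoid as SetoidReasoning

module CollatzPowerSeries {c ℓ : Level} (R : CommutativeRing c ℓ) where
  open CommutativeRing R
  open PowerSeries R

  -- Series with the pointwise (not the Cauchy) ring structure; only its additive group is used.
  module S = CommutativeRing (Pointwise.commutativeRing ℕ R)
  open SetoidReasoning S.setoid
  open CommutativeSemigroupProperties S.+-commutativeSemigroup using (interchange)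

  infixr 7 _•_ _⋆_

  _•_ : Carrier → PS → PS
  (a • f) k = a * f k

  mulX : PS → PS
  mulX f zero    = 0#
  mulX f (suc k) = f k

  mulX-cong : ∀ {f g} → f S.≈ g → mulX f S.≈ mulX g
  mulX-cong f≈g zero    = refl
  mulX-cong f≈g (suc k) = f≈g k

  mulX-+ : ∀ f g → mulX (f S.+ g) S.≈ mulX f S.+ mulX g
  mulX-+ f g zero    = sym (+-identityʳ 0#)
  mulX-+ f g (suc k) = refl

  mulX-• : ∀ a f → mulX (a • f) S.≈ a • mulX f
  mulX-• a f zero    = sym (zeroʳ a)
  mulX-• a f (suc k) = refl

  mulX-⟦⟧ : ∀ u → mulX ⟦ u ⟧ S.≈ ⟦ 0# ∷ u ⟧
  mulX-⟦⟧ u zero    = refl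
  mulX-⟦⟧ u (suc k) = refl

  -- p ⋆ f is the product ⟦ p ⟧ · f (see ·-⋆), computed by Horner's rule.
  _⋆_ : Poly → PS → PS
  []      ⋆ f = S.0#
  (a ∷ p) ⋆ f = a • f S.+ mulX (p ⋆ f)

  _⊕_ : Poly → Poly → Poly
  []      ⊕ q       = q
  (a ∷ p) ⊕ []      = a ∷ p
  (a ∷ p) ⊕ (b ∷ q) = a + b ∷ p ⊕ q

  ⟦⟧-⊕ : ∀ p q → ⟦ p ⊕ q ⟧ S.≈ ⟦ p ⟧ S.+ ⟦ q ⟧
  ⟦⟧-⊕ []      q       = S.sym (S.+-identityˡ ⟦ q ⟧)
  ⟦⟧-⊕ (a ∷ p) []      = S.sym (S.+-identityʳ ⟦ a ∷ p ⟧)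
  ⟦⟧-⊕ (a ∷ p) (b ∷ q) zero    = refl
  ⟦⟧-⊕ (a ∷ p) (b ∷ q) (suc k) = ⟦⟧-⊕ p q k

  ⋆-cong : ∀ p {f g} → f S.≈ g → p ⋆ f S.≈ p ⋆ g
  ⋆-cong []      f≈g = S.refl
  ⋆-cong (a ∷ p) f≈g = S.+-cong (λ k → *-congˡ (f≈g k)) (mulX-cong (⋆-cong p f≈g))

  ⋆-+ : ∀ p f g → p ⋆ (f S.+ g) S.≈ p ⋆ f S.+ p ⋆ g
  ⋆-+ []      f g = S.sym (S.+-identityʳ S.0#)
  ⋆-+ (a ∷ p) f g = begin
    a • (f S.+ g) S.+ mulX (p ⋆ (f S.+ g))
      ≈⟨ S.+-cong (λ k → distribˡ a (f k) (g k)) (mulX-cong (⋆-+ p f g)) ⟩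
    (a • f S.+ a • g) S.+ mulX (p ⋆ f S.+ p ⋆ g)
      ≈⟨ S.+-congˡ (mulX-+ (p ⋆ f) (p ⋆ g)) ⟩
    (a • f S.+ a • g) S.+ (mulX (p ⋆ f) S.+ mulX (p ⋆ g))
      ≈⟨ interchange (a • f) (a • g) _ _ ⟩
    (a ∷ p) ⋆ f S.+ (a ∷ p) ⋆ g ∎

  ⋆-• : ∀ p a f → p ⋆ (a • f) S.≈ a • (p ⋆ f)
  ⋆-• []      a f = λ _ → sym (zeroʳ a)
  ⋆-• (b ∷ p) a f = begin
    b • (a • f) S.+ mulX (p ⋆ (a • f))
      ≈⟨ S.+-cong (λ k → x∙yz≈y∙xz b a (f k)) (mulX-cong (⋆-• p a f)) ⟩
    a • (b • f) S.+ mulX (a • (p ⋆ f))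
      ≈⟨ S.+-congˡ (mulX-• a (p ⋆ f)) ⟩
    a • (b • f) S.+ a • mulX (p ⋆ f)
      ≈⟨ (λ k → sym (distribˡ a _ _)) ⟩
    a • ((b ∷ p) ⋆ f) ∎
    where open CommutativeSemigroupProperties *-commutativeSemigroup using (x∙yz≈y∙xz)

  ⋆-mulX : ∀ p f → p ⋆ mulX f S.≈ mulX (p ⋆ f)
  ⋆-mulX []      f zero    = refl
  ⋆-mulX []      f (suc k) = refl
  ⋆-mulX (a ∷ p) f zero    = trans (+-identityʳ _) (zeroʳ a)
  ⋆-mulX (a ∷ p) f (suc k) = +-congˡ (⋆-mulX p f k)

  0∷-⋆ : ∀ p f → (0# ∷ p) ⋆ f S.≈ mulX (p ⋆ f)
  0∷-⋆ p f k = trans (+-congʳ (zeroˡ (f k))) (+-identityˡ _)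

  ⊕-⋆ : ∀ p q f → (p ⊕ q) ⋆ f S.≈ p ⋆ f S.+ q ⋆ f
  ⊕-⋆ []      q       f = S.sym (S.+-identityˡ (q ⋆ f))
  ⊕-⋆ (a ∷ p) []      f = S.sym (S.+-identityʳ ((a ∷ p) ⋆ f))
  ⊕-⋆ (a ∷ p) (b ∷ q) f = begin
    (a + b) • f S.+ mulX ((p ⊕ q) ⋆ f)
      ≈⟨ S.+-cong (λ k → distribʳ (f k) a b) (mulX-cong (⊕-⋆ p q f)) ⟩
    (a • f S.+ b • f) S.+ mulX (p ⋆ f S.+ q ⋆ f)
      ≈⟨ S.+-congˡ (mulX-+ (p ⋆ f) (q ⋆ f)) ⟩
    (a • f S.+ b • f) S.+ (mulX (p ⋆ f) S.+ mulX (q ⋆ f))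
      ≈⟨ interchange (a • f) (b • f) _ _ ⟩
    (a ∷ p) ⋆ f S.+ (b ∷ q) ⋆ f ∎

  ∷⊕-⋆ : ∀ a p q f → (a ∷ p ⊕ q) ⋆ f S.≈ (a ∷ p) ⋆ f S.+ mulX (q ⋆ f)
  ∷⊕-⋆ a p q f = begin
    a • f S.+ mulX ((p ⊕ q) ⋆ f)              ≈⟨ S.+-congˡ (mulX-cong (⊕-⋆ p q f)) ⟩
    a • f S.+ mulX (p ⋆ f S.+ q ⋆ f)          ≈⟨ S.+-congˡ (mulX-+ (p ⋆ f) (q ⋆ f)) ⟩
    a • f S.+ (mulX (p ⋆ f) S.+ mulX (q ⋆ f)) ≈⟨ S.sym (S.+-assoc (a • f) _ _) ⟩
    (a ∷ p) ⋆ f S.+ mulX (q ⋆ f)              ∎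

  •-⋆ : ∀ a p f → map (a *_) p ⋆ f S.≈ a • (p ⋆ f)
  •-⋆ a []      f = λ _ → sym (zeroʳ a)
  •-⋆ a (b ∷ p) f = begin
    (a * b) • f S.+ mulX (map (a *_) p ⋆ f)
      ≈⟨ S.+-cong (λ k → *-assoc a b (f k)) (mulX-cong (•-⋆ a p f)) ⟩
    a • (b • f) S.+ mulX (a • (p ⋆ f))
      ≈⟨ S.+-congˡ (mulX-• a (p ⋆ f)) ⟩
    a • (b • f) S.+ a • mulX (p ⋆ f)
      ≈⟨ (λ k → sym (distribˡ a _ _)) ⟩
    a • ((b ∷ p) ⋆ f) ∎

  ⋆-constant : ∀ p b → p ⋆ ⟦ b ∷ [] ⟧ S.≈ ⟦ map (_* b) p ⟧
  ⋆-constant []      b k       = refl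
  ⋆-constant (a ∷ p) b zero    = +-identityʳ (a * b)
  ⋆-constant (a ∷ p) b (suc k) =
    trans (+-congʳ (zeroʳ a)) (trans (+-identityˡ _) (⋆-constant p b k))

  sumTo-cong : ∀ n {h h′ : ℕ → Carrier} →
               (∀ i → i ≤ n → h i ≈ h′ i) → sumTo n h ≈ sumTo n h′
  sumTo-cong zero    h≈h′ = h≈h′ 0 z≤n
  sumTo-cong (suc n) h≈h′ =
    +-cong (sumTo-cong n (λ i i≤n → h≈h′ i (m≤n⇒m≤1+n i≤n))) (h≈h′ (suc n) ≤-refl)

  sumTo-zero : ∀ n {h : ℕ → Carrier} → (∀ i → h i ≈ 0#) → sumTo n h ≈ 0#
  sumTo-zero zero    h≈0 = h≈0 0
  sumTo-zero (suc n) h≈0 =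
    trans (+-cong (sumTo-zero n h≈0) (h≈0 (suc n))) (+-identityʳ 0#)

  ·-unfold : ∀ f g → f · g S.≈ g 0 • f S.+ mulX (f · divX g)
  ·-unfold f g zero    = trans (*-comm (f 0) (g 0)) (sym (+-identityʳ _))
  ·-unfold f g (suc m) = trans (+-comm _ _) (+-cong lastTerm initialSum)
    where
    lastTerm : f (suc m) * g (m ∸ m) ≈ g 0 * f (suc m)
    lastTerm = trans (*-congˡ (reflexive (cong g (n∸n≡0 m)))) (*-comm _ _)
    initialSum : sumTo m (λ i → f i * g (suc m ∸ i)) ≈ sumTo m (λ i → f i * g (suc (m ∸ i)))
    initialSum = sumTo-cong m (λ i i≤m → *-congˡ (reflexive (cong g (+-∸-assoc 1 i≤m))))

  ·-⋆ : ∀ p {f g} → g S.≈ ⟦ p ⟧ → f · g S.≈ p ⋆ f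
  ·-⋆ []      {f} {g} g≈0 n = sumTo-zero n (λ i → trans (*-congˡ (g≈0 (n ∸ i))) (zeroʳ (f i)))
  ·-⋆ (a ∷ p) {f} {g} g≈ap  = S.trans (·-unfold f g)
    (S.+-cong (λ k → *-congʳ (g≈ap 0)) (mulX-cong (·-⋆ p (λ k → g≈ap (suc k)))))

  Tbar-mulX : ∀ {f g} → Tbar f g → ∃ λ e → mulX g S.+ ⟦ f 0 ∷ [] ⟧ S.≈ f S.+ mulX (e • f)
  Tbar-mulX {f} (inj₁ (_ , g≈)) = 1# , λ
    { zero    → +-comm 0# (f 0)
    ; (suc k) → trans (+-identityʳ _) (trans (g≈ k) (+-congˡ (sym (*-identityˡ _))))
    }
  Tbar-mulX {f} (inj₂ (_ , g≈)) = 0# , λ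
    { zero    → +-comm 0# (f 0)
    ; (suc k) → +-cong (g≈ k) (sym (zeroˡ (f k)))
    }

  infix 8 X^_
  X^_ : ℕ → Poly
  X^ zero  = 1# ∷ []
  X^ suc n = 0# ∷ X^ n

  LinearlyRelated : ℕ → PS → PS → Set (c ⊔ ℓ)
  LinearlyRelated n f h = ∃₂ λ p u → X^ n ⋆ h S.+ ⟦ u ⟧ S.≈ (1# ∷ p) ⋆ f

  linearlyRelated-step : ∀ n {f g h} →
                         Tbar f g → LinearlyRelated n g h → LinearlyRelated (suc n) f h
  linearlyRelated-step n {f} {g} {h} t (p , u , rel) with e , xg ← Tbar-mulX t =
    p ⊕ map (e *_) P , (0# ∷ u) ⊕ map (_* f 0) P , (begin
    X^ suc n ⋆ h S.+ ⟦ (0# ∷ u) ⊕ map (_* f 0) P ⟧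
      ≈⟨ S.+-cong (0∷-⋆ (X^ n) h) (⟦⟧-⊕ (0# ∷ u) (map (_* f 0) P)) ⟩
    mulX (X^ n ⋆ h) S.+ (⟦ 0# ∷ u ⟧ S.+ ⟦ map (_* f 0) P ⟧)
      ≈⟨ S.sym (S.+-assoc _ _ _) ⟩
    mulX (X^ n ⋆ h) S.+ ⟦ 0# ∷ u ⟧ S.+ ⟦ map (_* f 0) P ⟧
      ≈⟨ S.+-cong (S.+-congˡ (S.sym (mulX-⟦⟧ u))) (S.sym (⋆-constant P (f 0))) ⟩
    mulX (X^ n ⋆ h) S.+ mulX ⟦ u ⟧ S.+ P ⋆ ⟦ f 0 ∷ [] ⟧
      ≈⟨ S.+-congʳ (S.sym (mulX-+ (X^ n ⋆ h) ⟦ u ⟧)) ⟩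
    mulX (X^ n ⋆ h S.+ ⟦ u ⟧) S.+ P ⋆ ⟦ f 0 ∷ [] ⟧
      ≈⟨ S.+-congʳ (S.trans (mulX-cong rel) (S.sym (⋆-mulX P g))) ⟩
    P ⋆ mulX g S.+ P ⋆ ⟦ f 0 ∷ [] ⟧
      ≈⟨ S.sym (⋆-+ P _ _) ⟩
    P ⋆ (mulX g S.+ ⟦ f 0 ∷ [] ⟧)
      ≈⟨ ⋆-cong P xg ⟩
    P ⋆ (f S.+ mulX (e • f))
      ≈⟨ ⋆-+ P _ _ ⟩
    P ⋆ f S.+ P ⋆ mulX (e • f)
      ≈⟨ S.+-congˡ (⋆-mulX P (e • f)) ⟩
    P ⋆ f S.+ mulX (P ⋆ (e • f))
      ≈⟨ S.+-congˡ (mulX-cong (S.trans (⋆-• P e f) (S.sym (•-⋆ e P f)))) ⟩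
    P ⋆ f S.+ mulX (map (e *_) P ⋆ f)
      ≈⟨ S.sym (∷⊕-⋆ 1# p _ f) ⟩
    (1# ∷ p ⊕ map (e *_) P) ⋆ f ∎)
    where
    P : Poly
    P = 1# ∷ p

  tbarPow⇒linearlyRelated : ∀ n {f h} → TbarPow n f h → LinearlyRelated n f h
  tbarPow⇒linearlyRelated zero    (Level.lift f≈h) =
    [] , [] , S.trans (S.+-identityʳ _) (⋆-cong (X^ 0) (S.sym f≈h))
  tbarPow⇒linearlyRelated (suc n) (g , t , tⁿ) =
    linearlyRelated-step n t (tbarPow⇒linearlyRelated n tⁿ)

  linearlyRelated⇒InS : ∀ m {f} → LinearlyRelated (suc m) f f → InS f
  linearlyRelated⇒InS m {f} (p , u , rel) = u , v , (begin
    f · onePlusX v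
      ≈⟨ ·-⋆ (1# ∷ v) onePlusX≈ ⟩
    (1# ∷ p ⊕ map (- 1# *_) (X^ m)) ⋆ f
      ≈⟨ ∷⊕-⋆ 1# p _ f ⟩
    (1# ∷ p) ⋆ f S.+ mulX (map (- 1# *_) (X^ m) ⋆ f)
      ≈⟨ S.+-congˡ (S.trans (mulX-cong (•-⋆ (- 1#) (X^ m) f)) (mulX-• (- 1#) _)) ⟩
    (1# ∷ p) ⋆ f S.+ - 1# • mulX (X^ m ⋆ f)
      ≈⟨ S.+-cong (S.sym rel) (λ k → -1*x≈-x _) ⟩
    X^ suc m ⋆ f S.+ ⟦ u ⟧ S.+ S.- mulX (X^ m ⋆ f)
      ≈⟨ S.+-congʳ (S.+-congʳ (0∷-⋆ (X^ m) f)) ⟩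
    mulX (X^ m ⋆ f) S.+ ⟦ u ⟧ S.+ S.- mulX (X^ m ⋆ f)
      ≈⟨ xyx⁻¹≈y _ _ ⟩
    ⟦ u ⟧ ∎)
    where
    open RingProperties ring using (-1*x≈-x)
    open AbelianGroupProperties S.+-abelianGroup using (xyx⁻¹≈y)
    v : Poly
    v = p ⊕ map (- 1# *_) (X^ m)
    onePlusX≈ : onePlusX v S.≈ ⟦ 1# ∷ v ⟧
    onePlusX≈ zero    = refl
    onePlusX≈ (suc k) = refl

corollary3p4 : {c ℓ : Level} (R : CommutativeRing c ℓ) →
    ¬ (CommutativeRing._≈_ R (CommutativeRing.1# R) (CommutativeRing.0# R)) →
    (n : ℕ) → 1 ≤ n → (f : PowerSeries.PS R) →
    PowerSeries.TbarPow R n f f → PowerSeries.InS R f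
corollary3p4 R _ (suc m) _ f periodic =
  linearlyRelated⇒InS m (tbarPow⇒linearlyRelated (suc m) periodic)
  where open CollatzPowerSeries R
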